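{- If $G$ is a graph of order $n(G)$ that is not complete and satisfies $\Delta(G)=n(G)-1$, then $\chi_\mu(G)=2$.
   Context: $\Delta(G)$ is the maximum degree. For a connected graph $G$ and $S\subseteq V(G)$, two vertices $x,y\in S$ are $S$-visible if there is a shortest $x,y$-path $P$ in $G$ with $V(P)\cap S=\{x,y\}$. $S$ is a mutual-visibility set if any two vertices of $S$ are $S$-visible. A mutual-visibility coloring of $G$ is a partition of $V(G)$ into mutual-visibility sets, and the mutual-visibility chromatic number $\chi_\mu(G)$ is the smallest number of classes in such a partition. -}

module Defs where

open import Data.Nat using (ℕ; zero; suc; _⊔_; _≤_)
open import Data.Fin using (Fin)
open import Data.Bool using (Bool; true; false)
open import Data.List using (List; []; _∷_; length; map; foldr; filterᵇ; allFin)
open import Data.List.Relation.Unary.All using (All)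
open import Data.Product using (Σ; ∃; _×_; _,_)
open import Relation.Nullary using (¬_)
open import Relation.Binary.PropositionalEquality using (_≡_; _≢_)

record Graph (n : ℕ) : Set where
  field
    adj   : Fin n → Fin n → Bool
    sym   : ∀ x y → adj x y ≡ adj y x
    irrefl : ∀ x → adj x x ≡ false
open Graph public

order : ∀ {n} → Graph n → ℕ
order {n} _ = n

deg : ∀ {n} → Graph n → Fin n → ℕ
deg {n} G v = length (filterᵇ (adj G v) (allFin n))

maxDeg : ∀ {n} → Graph n → ℕ
maxDeg {n} G = foldr _⊔_ 0 (map (deg G) (allFin n))

Complete : ∀ {n} → Graph n → Set
Complete {n} G = ∀ (x y : Fin n) → x ≢ y → adj G x y ≡ true

data Walk {n} (G : Graph n) : Fin n → Fin n → ℕ → Set where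
  nil  : ∀ {x} → Walk G x x 0
  cons : ∀ {x y z k} → adj G x y ≡ true → Walk G y z k → Walk G x z (suc k)

inner : ∀ {n} {G : Graph n} {x y k} → Walk G x y k → List (Fin n)
inner nil = []
inner (cons e nil) = []
inner (cons {y = y} e (cons e' w)) = y ∷ inner (cons e' w)

-- a shortest x,y-path (a walk of minimum length; such walks are paths)
Shortest : ∀ {n} {G : Graph n} {x y k} → Walk G x y k → Set
Shortest {G = G} {x} {y} {k} _ = ∀ m → Walk G x y m → k ≤ m

Visible : ∀ {n} (G : Graph n) (S : Fin n → Set) → Fin n → Fin n → Set
Visible G S x y =
  Σ ℕ λ k → Σ (Walk G x y k) λ w → Shortest w × All (λ v → ¬ S v) (inner w)

MutualVisibility : ∀ {n} (G : Graph n) (S : Fin n → Set) → Set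
MutualVisibility {n} G S = ∀ (x y : Fin n) → S x → S y → Visible G S x y

MVColoring : ∀ {n} (G : Graph n) (k : ℕ) → (Fin n → Fin k) → Set
MVColoring G k c = ∀ (i : Fin _) → MutualVisibility G (λ v → c v ≡ i)

HasMVColoring : ∀ {n} (G : Graph n) (k : ℕ) → Set
HasMVColoring {n} G k = Σ (Fin n → Fin k) λ c → MVColoring G k c

MVChromaticNumber : ∀ {n} (G : Graph n) (k : ℕ) → Set
MVChromaticNumber G k = HasMVColoring G k × (∀ m → HasMVColoring G m → k ≤ m)

-- A vertex u of degree n − 1 is adjacent to every other vertex. Colour u alone
-- and everything else with a second colour: two vertices of the second class
-- are adjacent or at distance two through u, which lies outside the class, so
-- both classes are mutual-visibility sets. One colour cannot suffice, since
-- the whole vertex set is not a mutual-visibility set: a shortest path between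
-- two non-adjacent vertices has an inner vertex.
module Submission where

open import Defs hiding (sym)
open import Data.Nat using (ℕ; zero; suc; _∸_; _≤_; _⊔_; z≤n; s≤s)
open import Data.Nat.Properties using (⊔-sel; ⊔-identityʳ; m≤n⇒m≤1+n; <-irrefl)
open import Data.Fin using (Fin) renaming (zero to fzero; suc to fsuc)
open import Data.Fin.Properties using (_≟_; all?; ¬∀⟶∃¬)
open import Data.Bool using (Bool; true; false)
open import Data.Bool.Properties using (¬-not) renaming (_≟_ to _≟ᵇ_)
open import Data.List using (List; []; _∷_; length; map; foldr; filterᵇ; tabulate)
open import Data.List.Properties using (length-filter; length-tabulate)
open import Data.List.Membership.Propositional using (_∈_)
open import Data.List.Membership.Propositional.Properties using (∈-allFin)
open import Data.List.Relation.Unary.Any using (here; there)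
open import Data.List.Relation.Unary.All using () renaming ([] to []ᴬ; _∷_ to _∷ᴬ_)
open import Data.Product using (∃; _×_; _,_)
open import Data.Sum using (inj₁; inj₂)
open import Relation.Nullary using (¬_; Dec; yes; no; contradiction)
open import Relation.Nullary.Decidable using (_→-dec_; ¬?)
open import Relation.Binary.PropositionalEquality using (_≡_; _≢_; refl; sym; trans; subst; subst₂)

module _ {A : Set} (p : A → Bool) where

  length-filterᵇ-reject : ∀ {a} {xs : List A} → a ∈ xs → p a ≡ false →
    suc (length (filterᵇ p xs)) ≤ length xs
  length-filterᵇ-reject {xs = x ∷ xs} (here refl) pa≡false rewrite pa≡false =
    s≤s (length-filter _ xs)
  length-filterᵇ-reject {xs = x ∷ xs} (there a∈xs) pa≡false with p x
  ... | true  = s≤s (length-filterᵇ-reject a∈xs pa≡false)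
  ... | false = m≤n⇒m≤1+n (length-filterᵇ-reject a∈xs pa≡false)

  length-filterᵇ-reject₂ : ∀ {a b} {xs : List A} → a ∈ xs → b ∈ xs → a ≢ b →
    p a ≡ false → p b ≡ false → suc (suc (length (filterᵇ p xs))) ≤ length xs
  length-filterᵇ-reject₂ (here refl) (here refl) a≢b _ _ = contradiction refl a≢b
  length-filterᵇ-reject₂ (here refl) (there b∈xs) _ pa≡false pb≡false
    rewrite pa≡false = s≤s (length-filterᵇ-reject b∈xs pb≡false)
  length-filterᵇ-reject₂ (there a∈xs) (here refl) _ pa≡false pb≡false
    rewrite pb≡false = s≤s (length-filterᵇ-reject a∈xs pa≡false)
  length-filterᵇ-reject₂ {xs = x ∷ xs} (there a∈xs) (there b∈xs) a≢b pa≡false pb≡false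
    with p x
  ... | true  = s≤s (length-filterᵇ-reject₂ a∈xs b∈xs a≢b pa≡false pb≡false)
  ... | false = m≤n⇒m≤1+n (length-filterᵇ-reject₂ a∈xs b∈xs a≢b pa≡false pb≡false)

foldr-⊔-attained : ∀ {A : Set} (f : A → ℕ) (x : A) (xs : List A) →
  ∃ λ y → f y ≡ foldr _⊔_ 0 (map f (x ∷ xs))
foldr-⊔-attained f x [] = x , sym (⊔-identityʳ (f x))
foldr-⊔-attained f x (x′ ∷ xs) with ⊔-sel (f x) (foldr _⊔_ 0 (map f (x′ ∷ xs)))
... | inj₁ max≡fx = x , sym max≡fx
... | inj₂ max≡rest with foldr-⊔-attained f x′ xs
...   | y , fy≡rest = y , trans fy≡rest (sym max≡rest)

fin1-unique : (i : Fin 1) → i ≡ fzero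
fin1-unique fzero = refl

Universal : ∀ {n} → Graph n → Fin n → Set
Universal {n} G u = ∀ (w : Fin n) → u ≢ w → adj G u w ≡ true

isolate : ∀ {n} → Fin n → Fin n → Fin 2
isolate u v with v ≟ u
... | yes _ = fzero
... | no  _ = fsuc fzero

isolate-injectiveˡ : ∀ {n} (u x : Fin n) → isolate u x ≡ isolate u u → x ≡ u
isolate-injectiveˡ u x same with x ≟ u | u ≟ u
... | yes x≡u | _       = x≡u
... | no  _   | no u≢u  = contradiction refl u≢u
... | no  _   | yes _   with same
...   | ()

module _ {n} (G : Graph n) where

  distinct⇒adjacent? : ∀ x y → Dec (x ≢ y → adj G x y ≡ true)
  distinct⇒adjacent? x y = ¬? (x ≟ y) →-dec (adj G x y ≟ᵇ true)

  ¬complete⇒nonadjacent : ¬ Complete G →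
    ∃ λ x → ∃ λ y → x ≢ y × adj G x y ≡ false
  ¬complete⇒nonadjacent ¬complete
    with ¬∀⟶∃¬ n _ (λ x → all? (λ y → distinct⇒adjacent? x y)) ¬complete
  ... | x , ¬x-universal with ¬∀⟶∃¬ n _ (distinct⇒adjacent? x) ¬x-universal
  ...   | y , ¬xy = x , y , (λ x≡y → ¬xy (λ x≢y → contradiction x≡y x≢y))
                          , ¬-not (λ xy → ¬xy (λ _ → xy))

  deg≡pred⇒universal : ∀ u → deg G u ≡ n ∸ 1 → Universal G u
  deg≡pred⇒universal u deg≡n-1 w u≢w with adj G u w in u≁w
  ... | true  = refl
  ... | false = contradiction two-non-neighbours (too-many n)
    where
    two-non-neighbours : suc (suc (n ∸ 1)) ≤ n
    two-non-neighbours =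
      subst₂ (λ d l → suc (suc d) ≤ l) deg≡n-1 (length-tabulate (λ i → i))
        (length-filterᵇ-reject₂ (adj G u) (∈-allFin u) (∈-allFin w) u≢w (irrefl G u) u≁w)
    too-many : ∀ k → ¬ (suc (suc (k ∸ 1)) ≤ k)
    too-many zero    ()
    too-many (suc k) (s≤s k+1≤k) = <-irrefl refl k+1≤k

  walk₀⇒≡ : ∀ {x y} → Walk G x y 0 → x ≡ y
  walk₀⇒≡ nil = refl

  walk₁⇒adjacent : ∀ {x y} → Walk G x y 1 → adj G x y ≡ true
  walk₁⇒adjacent (cons xy nil) = xy

  module _ (S : Fin n → Set) where

    visible-refl : ∀ x → Visible G S x x
    visible-refl x = 0 , nil , (λ _ _ → z≤n) , []ᴬ

    visible-adjacent : ∀ {x y} → x ≢ y → adj G x y ≡ true → Visible G S x y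
    visible-adjacent {x} {y} x≢y x∼y = 1 , cons x∼y nil , shortest , []ᴬ
      where
      shortest : ∀ m → Walk G x y m → 1 ≤ m
      shortest zero    w = contradiction (walk₀⇒≡ w) x≢y
      shortest (suc m) _ = s≤s z≤n

    visible-through : ∀ {x u y} → x ≢ y → adj G x y ≡ false →
      adj G x u ≡ true → adj G u y ≡ true → ¬ S u → Visible G S x y
    visible-through {x} {u} {y} x≢y x≁y x∼u u∼y ¬Su =
      2 , cons x∼u (cons u∼y nil) , shortest , ¬Su ∷ᴬ []ᴬ
      where
      shortest : ∀ m → Walk G x y m → 2 ≤ m
      shortest zero          w = contradiction (walk₀⇒≡ w) x≢y
      shortest (suc zero)    w = contradiction (trans (sym (walk₁⇒adjacent w)) x≁y) λ ()
      shortest (suc (suc m)) _ = s≤s (s≤s z≤n)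

    visible-nonadjacent⇒outside : ∀ {x y} → x ≢ y → adj G x y ≡ false →
      Visible G S x y → ∃ λ v → ¬ S v
    visible-nonadjacent⇒outside x≢y x≁y (_ , nil , _) = contradiction refl x≢y
    visible-nonadjacent⇒outside x≢y x≁y (_ , cons x∼y nil , _) =
      contradiction (trans (sym x∼y) x≁y) λ ()
    visible-nonadjacent⇒outside x≢y x≁y (_ , cons _ (cons _ _) , _ , ¬Sv ∷ᴬ _) = _ , ¬Sv

    subsingleton⇒mutualVisibility : (∀ {x y} → S x → S y → x ≡ y) → MutualVisibility G S
    subsingleton⇒mutualVisibility unique x y Sx Sy =
      subst (Visible G S x) (unique Sx Sy) (visible-refl x)

    universal⇒mutualVisibility : ∀ {u} → Universal G u → ¬ S u → MutualVisibility G S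
    universal⇒mutualVisibility {u} u-universal ¬Su x y Sx Sy with x ≟ y
    ... | yes refl = visible-refl x
    ... | no x≢y with adj G x y in x∼y
    ...   | true  = visible-adjacent x≢y x∼y
    ...   | false = visible-through x≢y x∼y (neighbour Sx) (u-universal y (outside Sy)) ¬Su
      where
      outside : ∀ {v} → S v → u ≢ v
      outside Sv refl = ¬Su Sv
      neighbour : ∀ {v} → S v → adj G v u ≡ true
      neighbour {v} Sv = trans (Graph.sym G v u) (u-universal v (outside Sv))

  isolate-mvColoring : ∀ {u} → Universal G u → MVColoring G 2 (isolate u)
  isolate-mvColoring {u} u-universal i with isolate u u ≟ i
  ... | yes refl = subsingleton⇒mutualVisibility _ λ {x} {y} cx≡cu cy≡cu →
          trans (isolate-injectiveˡ u x cx≡cu) (sym (isolate-injectiveˡ u y cy≡cu))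
  ... | no  cu≢i = universal⇒mutualVisibility _ u-universal cu≢i

  nonadjacent⇒2≤colours : ∀ {x y} → x ≢ y → adj G x y ≡ false →
    ∀ m → HasMVColoring G m → 2 ≤ m
  nonadjacent⇒2≤colours {x} _ _ zero (c , _) with c x
  ... | ()
  nonadjacent⇒2≤colours {x} {y} x≢y x≁y (suc zero) (c , mv)
    with visible-nonadjacent⇒outside _ x≢y x≁y
           (mv fzero x y (fin1-unique (c x)) (fin1-unique (c y)))
  ... | v , cv≢0 = contradiction (fin1-unique (c v)) cv≢0
  nonadjacent⇒2≤colours _ _ (suc (suc m)) _ = s≤s (s≤s z≤n)

maxDeg-attained : ∀ {n} (G : Graph (suc n)) → ∃ λ v → deg G v ≡ maxDeg G
maxDeg-attained G = foldr-⊔-attained (deg G) fzero (tabulate fsuc)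

corollary5p5 : ∀ {n} (G : Graph n) → ¬ Complete G → maxDeg G ≡ order G ∸ 1 →
    MVChromaticNumber G 2
corollary5p5 {zero} G ¬complete _ = contradiction (λ ()) ¬complete
corollary5p5 {suc n} G ¬complete maxDeg≡n
  with ¬complete⇒nonadjacent G ¬complete | maxDeg-attained G
... | _ , _ , x≢y , x≁y | u , deg≡maxDeg =
  (isolate u , isolate-mvColoring G u-universal) , nonadjacent⇒2≤colours G x≢y x≁y
  where
  u-universal : Universal G u
  u-universal = deg≡pred⇒universal G u (trans deg≡maxDeg maxDeg≡n)
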